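{- Let $(N,\mathcal{W})$ be a complete simple game with equivalence classes $N_1,\dots,N_t$ ordered by decreasing desirability, $n_j=|N_j|$, and shift-minimal winning vectors $m^1,\dots,m^r$, $m^h=(m^h_1,\dots,m^h_t)$. Then for every $1\le h\le r$, $$\nu(N,\mathcal{W})\le\max_{1\le i\le t}\left\lceil\frac{\sum_{j=1}^i n_j}{\sum_{j=1}^i (n_j-m^h_j)}\right\rceil,$$ with $x/0$ interpreted as $\infty$.
   Context: A simple game $(N,\mathcal{W})$: $N$ finite, $\mathcal{W}$ a family of subsets (winning coalitions) with $\emptyset\notin\mathcal{W}$, $N\in\mathcal{W}$, closed under supersets; $\nu(N,\mathcal{W})$ is the minimum number of winning coalitions with empty intersection ($\infty$ if none). Write $i\sqsupseteq j$ if for every $S$ with $j\in S\subseteq N\setminus\{i\}$, $S\in\mathcal{W}$ implies $(S\setminus\{j\})\cup\{i\}\in\mathcal{W}$. The game is complete if $\sqsupseteq$ is a total preorder; its equivalence classes $N_1,\dots,N_t$ are ordered so that players in $N_a$ are strictly more desirable than those in $N_b$ for $a<b$. The coalition vector of $S$ is $(|S\cap N_1|,\dots,|S\cap N_t|)$. For $u,v\in\mathbb{N}_{\ge0}^t$ write $u\preceq v$ if $\sum_{j\le i}u_j\le\sum_{j\le i}v_j$ for all $i$. A winning coalition vector $u$ is shift-minimal winning if every coalition vector $v\preceq u$, $v\ne u$, is losing. -}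

module Defs where

open import Data.Nat using (ℕ; _∸_; _⊔_; NonZero; _≤_) renaming (zero to 0ℕ; suc to sucℕ)
open import Data.Nat using (_+_; _<_)
open import Data.Nat.DivMod using (_/_)
open import Data.Fin using (Fin; toℕ; zero; suc) renaming (_≤_ to _≤ᶠ_)
open import Data.Fin.Subset using (Subset; _∈_; _∉_; _⊆_; _∩_; _∪_; _-_; ⁅_⁆; ⊥; ⊤; ∣_∣)
open import Data.Bool using (Bool; true; false)
open import Data.Vec using (Vec; tabulate; foldr)
open import Data.Fin using (_≟_)
open import Relation.Nullary.Decidable using (does)
open import Data.List using (List; length; map) renaming (foldr to lfoldr)
open import Data.List using () renaming (allFin to allFinL)
open import Data.List.Relation.Unary.All using (All)
open import Data.Maybe using (Maybe; just; nothing)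
open import Data.Product using (Σ; _×_; ∃; ∃-syntax)
open import Data.Sum using (_⊎_)
open import Relation.Binary.PropositionalEquality using (_≡_)
open import Relation.Nullary using (¬_)
open import Function.Bundles using (_⇔_)

record IsSimpleGame {n : ℕ} (W : Subset n → Set) : Set where
  field
    empty-losing  : ¬ W ⊥
    grand-winning : W ⊤
    monotone      : ∀ {S T} → S ⊆ T → W S → W T

Desirable : {n : ℕ} → (Subset n → Set) → Fin n → Fin n → Set
Desirable {n} W i j = ∀ (S : Subset n) → j ∈ S → i ∉ S → W S → W ((S - j) ∪ ⁅ i ⁆)

record IsComplete {n : ℕ} (W : Subset n → Set) : Set where
  field
    refl′  : ∀ i → Desirable W i i
    trans′ : ∀ i j k → Desirable W i j → Desirable W j k → Desirable W i k
    total  : ∀ i j → Desirable W i j ⊎ Desirable W j i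

-- A class map c : N → Fin t describing the equivalence classes N_1,…,N_t
-- (N_{a+1} = c⁻¹(a)), ordered by decreasing desirability:
-- c i ≤ c j  iff  i ⊒ j, and every class is nonempty.
record IsClassMap {n t : ℕ} (W : Subset n → Set) (c : Fin n → Fin t) : Set where
  field
    order    : ∀ i j → (c i ≤ᶠ c j) ⇔ Desirable W i j
    nonempty : ∀ (a : Fin t) → ∃[ i ] c i ≡ a

classSet : {n t : ℕ} → (Fin n → Fin t) → Fin t → Subset n
classSet c a = tabulate (λ p → does (c p ≟ a))

classSize : {n t : ℕ} → (Fin n → Fin t) → Fin t → ℕ
classSize c a = ∣ classSet c a ∣

coalVec : {n t : ℕ} → (Fin n → Fin t) → Subset n → Fin t → ℕ
coalVec c S a = ∣ S ∩ classSet c a ∣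

psum : {t : ℕ} → (Fin t → ℕ) → Fin t → ℕ
psum u zero    = u zero
psum u (suc i) = u zero + psum (λ j → u (suc j)) i

_⪯_ : {t : ℕ} → (Fin t → ℕ) → (Fin t → ℕ) → Set
u ⪯ v = ∀ i → psum u i ≤ psum v i

_≐_ : {t : ℕ} → (Fin t → ℕ) → (Fin t → ℕ) → Set
u ≐ v = ∀ i → u i ≡ v i

record IsShiftMinWinning {n t : ℕ} (W : Subset n → Set) (c : Fin n → Fin t)
                         (m : Fin t → ℕ) : Set where
  field
    winning : ∃[ S ] (coalVec c S ≐ m × W S)
    minimal : ∀ S → coalVec c S ⪯ m → ¬ (coalVec c S ≐ m) → ¬ W S

ceilDiv : ℕ → (q : ℕ) → .{{NonZero q}} → ℕ
ceilDiv p (sucℕ q) = (p + q) / sucℕ q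

-- ⌈ p / q ⌉ with p/0 = ∞ (nothing)
ceilDiv∞ : ℕ → ℕ → Maybe ℕ
ceilDiv∞ p 0ℕ    = nothing
ceilDiv∞ p (sucℕ q) = just (ceilDiv p (sucℕ q))

max∞ : Maybe ℕ → Maybe ℕ → Maybe ℕ
max∞ (just a) (just b) = just (a ⊔ b)
max∞ _        _        = nothing

bound : {n t : ℕ} → (Fin n → Fin t) → (Fin t → ℕ) → Maybe ℕ
bound {t = t} c m =
  lfoldr max∞ (just 0)
    (map (λ i → ceilDiv∞ (psum (classSize c) i)
                         (psum (λ j → classSize c j ∸ m j) i))
         (allFinL t))

⋂ : {n : ℕ} → List (Subset n) → Subset n
⋂ = lfoldr _∩_ ⊤

ν≤ : {n : ℕ} → (Subset n → Set) → ℕ → Set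
ν≤ W k = ∃[ Ss ] (length Ss ≤ k × All W Ss × ⋂ Ss ≡ ⊥)

-- Let S₀ be a winning coalition with vector m and list the players by class, the members
-- of S₀ last within each class. The bound b says that every initial segment of classes
-- N₁ ∪ … ∪ Nᵢ contains at least a 1/b fraction of non-members of S₀; by the ordering this
-- holds for every prefix of the list. Deal the list round robin into b hands Hₖ. A prefix
-- of length ℓ meets each hand at most ⌈ℓ/b⌉ times, hence at most as often as it meets the
-- complement of S₀, so the complement of Hₖ dominates S₀ prefix by prefix; trading members
-- of S₀ for earlier, hence more desirable, players shows that it wins. These b winning
-- coalitions have empty intersection.
module Submission where

open import Defs
open import Data.Bool using (true; false; if_then_else_)
open import Data.Fin using (Fin; zero; suc; toℕ; _≟_) renaming (_≤_ to _≤ᶠ_)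
open import Data.Fin.Properties using () renaming (_≤?_ to _≤ᶠ?_; ≤-refl to ≤ᶠ-refl)
open import Data.Fin.Subset using (Subset; _∈_; _∉_; _-_; _∪_; _∩_; ⁅_⁆; ∁; ∣_∣; inside; outside)
open import Data.Fin.Subset.Properties
  using (_∈?_; drop-there; p─q⊆p; x∈p∪q⁻; x∈⁅y⁆⇒x≡y; x∈p∩q⁺; x∈p∩q⁻; x∈∁p⇒x∉p; x∉p⇒x∈∁p;
         Empty-unique)
open import Data.List
  using (List; []; _∷_; _++_; [_]; _∷ʳ_; length; filter; map; take; drop; upTo; applyUpTo; allFin)
import Data.List as List
open import Data.List.Properties
  using (++-assoc; length-++; filter-++; map-upTo; map-∘; map-cong-local; map-tabulate;
         take++drop≡id; length-map; length-upTo)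
open import Data.List.Membership.Propositional using () renaming (_∈_ to _∈ₗ_; _∉_ to _∉ₗ_)
open import Data.List.Membership.Propositional.Properties
  using (∈-++⁺ʳ; ∈-upTo⁺; ∈-upTo⁻; ∈-allFin)
open import Data.List.Relation.Binary.Permutation.Propositional using (_↭_; ↭-sym; ↭-refl; ↭⇒↭ₛ)
open import Data.List.Relation.Binary.Permutation.Propositional.Properties
  using (↭-length; filter-↭; ∈-resp-↭)
open import Data.List.Relation.Binary.Permutation.Setoid.Properties using (Unique-resp-↭)
open import Data.List.Relation.Unary.All as All using (All; []; _∷_)
import Data.List.Relation.Unary.All.Properties as All
open import Data.List.Relation.Unary.AllPairs as AllPairs using (AllPairs; []; _∷_)
open import Data.List.Relation.Unary.Any using (here; there)
open import Data.List.Relation.Unary.Sorted.TotalOrder.Properties using (Sorted⇒AllPairs)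
open import Data.List.Relation.Unary.Unique.Propositional using (Unique)
open import Data.List.Relation.Unary.Unique.Propositional.Properties using (allFin⁺; upTo⁺)
open import Data.List.Reverse using (Reverse; reverseView; []; _∶_∶ʳ_)
import Data.List.Sort
open import Data.Vec using ([]; _∷_; tabulate; here; there)
open import Data.Vec.Properties using (lookup∘tabulate; []=⇒lookup; lookup⇒[]=)
open import Data.Maybe using (Maybe; just; nothing)
open import Data.Maybe.Relation.Binary.Pointwise using (Pointwise; just)
open import Data.Nat
  using (ℕ; zero; suc; _+_; _*_; _∸_; _≤_; _<_; _⊔_; z≤n; s≤s; s≤s⁻¹; pred; NonZero)
import Data.Nat as ℕ
open import Data.Nat.DivMod using (_/_; _%_; m≡m%n+[m/n]*n; m%n<n; [m+n]%n≡m%n; m<n⇒m%n≡m)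
open import Data.Nat.Properties
  using (≤-refl; ≤-reflexive; ≤-trans; ≤-decTotalOrder; <⇒≱; ≮⇒≥; 1+n≰n; n≤1+n; m≤n⇒m≤1+n;
         m≤m+n; m≤m⊔n; m≤n⊔m; m+[n∸m]≡n; m+n∸m≡n; +-suc; +-comm; +-identityʳ; +-mono-≤;
         +-monoˡ-≤; +-monoʳ-≤; +-cancelʳ-≤; *-suc; *-comm; *-identityʳ; *-distribˡ-+; *-monoˡ-≤;
         *-monoʳ-≤; pred-mono-≤; +-commutativeSemigroup; module ≤-Reasoning)
open import Algebra.Properties.CommutativeSemigroup +-commutativeSemigroup using (interchange)
open import Data.Product using (∃-syntax; _×_; _,_; proj₁; proj₂)
open import Data.Sum using (_⊎_; inj₁; inj₂)
open import Function using (_∘_; id)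
open import Function.Bundles using (Equivalence)
open import Level using (Level; 0ℓ)
open import Relation.Binary.Bundles using (DecTotalOrder)
open import Relation.Binary.Core using (Rel)
open import Relation.Binary.Definitions using (DecidableEquality)
import Relation.Binary.Construct.On as On
open import Relation.Binary.PropositionalEquality hiding ([_])
open import Relation.Nullary using (yes; no; does; ¬_; contradiction)
open import Relation.Nullary.Decidable using (dec-true)
open import Relation.Unary using (Pred; Decidable)
import Relation.Unary as U
open import Relation.Unary.Properties using (∁?; _∩?_)

private variable
  ℓ ℓ′ : Level
  A B : Set ℓ
  n t : ℕ

count : {P : Pred A ℓ} → Decidable P → List A → ℕ
count P? []       = 0
count P? (x ∷ xs) = if does (P? x) then suc (count P? xs) else count P? xs

module _ {P : Pred A ℓ} (P? : Decidable P) where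

  count-accept : ∀ {x} xs → P x → count P? (x ∷ xs) ≡ suc (count P? xs)
  count-accept {x} _ px with P? x
  ... | yes _   = refl
  ... | no  ¬px = contradiction px ¬px

  count-reject : ∀ {x} xs → ¬ P x → count P? (x ∷ xs) ≡ count P? xs
  count-reject {x} _ ¬px with P? x
  ... | yes px = contradiction px ¬px
  ... | no  _  = refl

  count-++ : ∀ xs ys → count P? (xs ++ ys) ≡ count P? xs + count P? ys
  count-++ []       ys = refl
  count-++ (x ∷ xs) ys with does (P? x)
  ... | true  = cong suc (count-++ xs ys)
  ... | false = count-++ xs ys

  count-≤-length : ∀ xs → count P? xs ≤ length xs
  count-≤-length []       = z≤n
  count-≤-length (x ∷ xs) with does (P? x)
  ... | true  = s≤s (count-≤-length xs)
  ... | false = m≤n⇒m≤1+n (count-≤-length xs)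

  count-pos : ∀ {x xs} → x ∈ₗ xs → P x → 0 < count P? xs
  count-pos {xs = y ∷ ys} (here refl) px = ≤-trans (s≤s z≤n) (≤-reflexive (sym (count-accept ys px)))
  count-pos {xs = y ∷ ys} (there x∈)  px with does (P? y)
  ... | true  = s≤s z≤n
  ... | false = count-pos x∈ px

  count-all : ∀ {xs} → All P xs → count P? xs ≡ length xs
  count-all []                  = refl
  count-all {_ ∷ xs} (px ∷ pxs) = trans (count-accept xs px) (cong suc (count-all pxs))

  count-none : ∀ {xs} → All (¬_ ∘ P) xs → count P? xs ≡ 0
  count-none []                    = refl
  count-none {_ ∷ xs} (¬px ∷ ¬pxs) = trans (count-reject xs ¬px) (count-none ¬pxs)

  count-+-count-∁ : ∀ xs → count P? xs + count (∁? P?) xs ≡ length xs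
  count-+-count-∁ []       = refl
  count-+-count-∁ (x ∷ xs) with P? x
  ... | yes _ = cong suc (count-+-count-∁ xs)
  ... | no  _ = trans (+-suc _ _) (cong suc (count-+-count-∁ xs))

  count-map : ∀ (f : B → A) xs → count P? (map f xs) ≡ count (P? ∘ f) xs
  count-map f []       = refl
  count-map f (x ∷ xs) with does (P? (f x))
  ... | true  = cong suc (count-map f xs)
  ... | false = count-map f xs

  count≡length∘filter : ∀ xs → count P? xs ≡ length (filter P? xs)
  count≡length∘filter []       = refl
  count≡length∘filter (x ∷ xs) with does (P? x)
  ... | true  = cong suc (count≡length∘filter xs)
  ... | false = count≡length∘filter xs

  count-↭ : ∀ {xs ys} → xs ↭ ys → count P? xs ≡ count P? ys
  count-↭ {xs} {ys} xs↭ys = begin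
    count P? xs            ≡⟨ count≡length∘filter xs ⟩
    length (filter P? xs)  ≡⟨ ↭-length (filter-↭ P? xs↭ys) ⟩
    length (filter P? ys)  ≡⟨ count≡length∘filter ys ⟨
    count P? ys            ∎
    where open ≡-Reasoning

  module _ {Q : Pred A ℓ′} (Q? : Decidable Q) where

    count-mono : ∀ xs → (∀ {x} → x ∈ₗ xs → P x → Q x) → count P? xs ≤ count Q? xs
    count-mono []       P⇒Q = z≤n
    count-mono (x ∷ xs) P⇒Q with P? x | Q? x
    ... | yes _  | yes _   = s≤s (count-mono xs (P⇒Q ∘ there))
    ... | yes px | no  ¬qx = contradiction (P⇒Q (here refl) px) ¬qx
    ... | no  _  | yes _   = m≤n⇒m≤1+n (count-mono xs (P⇒Q ∘ there))
    ... | no  _  | no  _   = count-mono xs (P⇒Q ∘ there)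

    count-≐ : P U.≐ Q → ∀ xs → count P? xs ≡ count Q? xs
    count-≐ P≐Q []       = refl
    count-≐ P≐Q (x ∷ xs) with P? x | Q? x
    ... | yes _  | yes _   = cong suc (count-≐ P≐Q xs)
    ... | yes px | no  ¬qx = contradiction (proj₁ P≐Q px) ¬qx
    ... | no ¬px | yes qx  = contradiction (proj₂ P≐Q qx) ¬px
    ... | no  _  | no  _   = count-≐ P≐Q xs

    count-filter : ∀ xs → count Q? (filter P? xs) ≡ count (P? ∩? Q?) xs
    count-filter []       = refl
    count-filter (x ∷ xs) with P? x
    ... | no  _ = count-filter xs
    ... | yes _ with Q? x
    ...   | yes _ = cong suc (count-filter xs)
    ...   | no  _ = count-filter xs

    count-partition : ∀ xs → count Q? xs ≡ count Q? (filter P? xs) + count Q? (filter (∁? P?) xs)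
    count-partition []       = refl
    count-partition (x ∷ xs) with P? x
    ... | yes _ with Q? x
    ...   | yes _ = cong suc (count-partition xs)
    ...   | no  _ = count-partition xs
    count-partition (x ∷ xs) | no _ with Q? x
    ...   | yes _ = trans (cong suc (count-partition xs)) (sym (+-suc _ _))
    ...   | no  _ = count-partition xs

count-filter-≤ : ∀ {P : Pred A ℓ} {Q : Pred A ℓ′} (P? : Decidable P) (Q? : Decidable Q) xs →
                 count Q? (filter P? xs) ≤ count P? xs
count-filter-≤ P? Q? xs =
  ≤-trans (count-≤-length Q? (filter P? xs)) (≤-reflexive (sym (count≡length∘filter P? xs)))

count-≡-≤1 : (_≟ₐ_ : DecidableEquality A) (a : A) {xs : List A} → Unique xs → count (_≟ₐ a) xs ≤ 1
count-≡-≤1 _≟ₐ_ a {[]}     _            = z≤n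
count-≡-≤1 _≟ₐ_ a {x ∷ xs} (x≢xs ∷ uniq) with x ≟ₐ a
... | yes refl = s≤s (≤-reflexive (count-none (_≟ₐ a) (All.map ≢-sym x≢xs)))
... | no  _    = count-≡-≤1 _≟ₐ_ a uniq

residue? : ∀ b .{{_ : NonZero b}} k → Decidable (λ i → i % b ≡ k)
residue? b k i = i % b ℕ.≟ k

applyUpTo-++ : ∀ (f : ℕ → A) m k → applyUpTo f (m + k) ≡ applyUpTo f m ++ applyUpTo (f ∘ (m +_)) k
applyUpTo-++ f zero    k = refl
applyUpTo-++ f (suc m) k = cong (f 0 ∷_) (applyUpTo-++ (f ∘ suc) m k)

count-upTo-mono : ∀ {P : Pred ℕ ℓ} (P? : Decidable P) {m N} → m ≤ N →
                  count P? (upTo m) ≤ count P? (upTo N)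
count-upTo-mono P? {m} {N} m≤N = begin
  count P? (upTo m)                                        ≤⟨ m≤m+n _ _ ⟩
  count P? (upTo m) + count P? (applyUpTo (m +_) (N ∸ m))  ≡⟨ count-++ P? (upTo m) _ ⟨
  count P? (upTo m ++ applyUpTo (m +_) (N ∸ m))            ≡⟨ cong (count P?) (applyUpTo-++ id m (N ∸ m)) ⟨
  count P? (upTo (m + (N ∸ m)))                            ≡⟨ cong (count P? ∘ upTo) (m+[n∸m]≡n m≤N) ⟩
  count P? (upTo N)                                        ∎
  where open ≤-Reasoning

module _ (b : ℕ) .{{_ : NonZero b}} (k : ℕ) where

  count-residue-blocks : ∀ C → count (residue? b k) (upTo (C * b)) ≤ C
  count-residue-blocks zero    = z≤n
  count-residue-blocks (suc C) = begin
    count (residue? b k) (upTo (b + C * b))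
      ≡⟨ cong (count (residue? b k)) (applyUpTo-++ id b (C * b)) ⟩
    count (residue? b k) (upTo b ++ applyUpTo (b +_) (C * b))
      ≡⟨ count-++ (residue? b k) (upTo b) _ ⟩
    count (residue? b k) (upTo b) + count (residue? b k) (applyUpTo (b +_) (C * b))
      ≡⟨ cong (count (residue? b k) (upTo b) +_) later-blocks ⟩
    count (residue? b k) (upTo b) + count (residue? b k) (upTo (C * b))
      ≤⟨ +-mono-≤ first-block (count-residue-blocks C) ⟩
    1 + C
      ∎
    where
    open ≤-Reasoning
    first-block : count (residue? b k) (upTo b) ≤ 1
    first-block = ≤-trans
      (count-mono (residue? b k) (ℕ._≟ k) (upTo b) λ i∈ → trans (sym (m<n⇒m%n≡m (∈-upTo⁻ i∈))))
      (count-≡-≤1 ℕ._≟_ k (upTo⁺ b))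
    %-periodic : ∀ i → (b + i) % b ≡ i % b
    %-periodic i = trans (cong (_% b) (+-comm b i)) ([m+n]%n≡m%n i b)
    later-blocks : count (residue? b k) (applyUpTo (b +_) (C * b)) ≡ count (residue? b k) (upTo (C * b))
    later-blocks = begin-equality
      count (residue? b k) (applyUpTo (b +_) (C * b))
        ≡⟨ cong (count (residue? b k)) (map-upTo (b +_) (C * b)) ⟨
      count (residue? b k) (map (b +_) (upTo (C * b)))
        ≡⟨ count-map (residue? b k) (b +_) (upTo (C * b)) ⟩
      count (residue? b k ∘ (b +_)) (upTo (C * b))
        ≡⟨ count-≐ _ (residue? b k) (trans (sym (%-periodic _)) , trans (%-periodic _)) (upTo (C * b)) ⟩
      count (residue? b k) (upTo (C * b))
        ∎

  count-residue : ∀ {m} C → m ≤ C * b → count (residue? b k) (upTo m) ≤ C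
  count-residue C m≤Cb = ≤-trans (count-upTo-mono (residue? b k) m≤Cb) (count-residue-blocks C)

-- Junk value 0 for elements not in the list.
position : List (Fin n) → Fin n → ℕ
position []      p = 0
position (q ∷ Q) p with p ≟ q
... | yes _ = 0
... | no  _ = suc (position Q p)

map-position-take : ∀ y (P : List (Fin n)) → Unique P → map (position P) (take y P) ≡ upTo (length (take y P))
map-position-take zero    P       _              = refl
map-position-take (suc y) []      _              = refl
map-position-take (suc y) (q ∷ P) (q≢P ∷ unique) = cong₂ _∷_ position-head (begin
  map (position (q ∷ P)) (take y P)      ≡⟨ map-cong-local (All.map position-tail (All.take⁺ y q≢P)) ⟩
  map (suc ∘ position P) (take y P)      ≡⟨ map-∘ (take y P) ⟩
  map suc (map (position P) (take y P))  ≡⟨ cong (map suc) (map-position-take y P unique) ⟩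
  map suc (upTo (length (take y P)))     ≡⟨ map-upTo suc _ ⟩
  applyUpTo suc (length (take y P))      ∎)
  where
  open ≡-Reasoning
  position-head : position (q ∷ P) q ≡ 0
  position-head with q ≟ q
  ... | yes _   = refl
  ... | no  q≢q = contradiction refl q≢q
  position-tail : ∀ {p} → q ≢ p → position (q ∷ P) p ≡ suc (position P p)
  position-tail {p} q≢p with p ≟ q
  ... | yes p≡q = contradiction (sym p≡q) q≢p
  ... | no  _   = refl

module _ {P : Pred (Fin n) ℓ} (P? : Decidable P) where

  ∈-tabulate⁻ : ∀ {x} → x ∈ tabulate (does ∘ P?) → P x
  ∈-tabulate⁻ {x} x∈ with P? x | trans (sym (lookup∘tabulate (does ∘ P?) x)) ([]=⇒lookup x∈)
  ... | yes px | _ = px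

  ∈-tabulate⁺ : ∀ {x} → P x → x ∈ tabulate (does ∘ P?)
  ∈-tabulate⁺ {x} px = lookup⇒[]= x _ (trans (lookup∘tabulate (does ∘ P?) x) (dec-true (P? x) px))

  count-∈-tabulate : ∀ xs → count (_∈? tabulate (does ∘ P?)) xs ≡ count P? xs
  count-∈-tabulate = count-≐ _ P? (∈-tabulate⁻ , ∈-tabulate⁺)

count-∈-suc : ∀ s (X : Subset n) → count (_∈? s ∷ X) (List.tabulate suc) ≡ count (_∈? X) (allFin n)
count-∈-suc {n} s X = begin
  count (_∈? s ∷ X) (List.tabulate suc)    ≡⟨ cong (count (_∈? s ∷ X)) (map-tabulate id suc) ⟨
  count (_∈? s ∷ X) (map suc (allFin n))   ≡⟨ count-map (_∈? s ∷ X) suc (allFin n) ⟩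
  count ((_∈? s ∷ X) ∘ suc) (allFin n)     ≡⟨ count-≐ _ (_∈? X) (drop-there , there) (allFin n) ⟩
  count (_∈? X) (allFin n)                 ∎
  where open ≡-Reasoning

∣p∣≡count-allFin : ∀ (X : Subset n) → ∣ X ∣ ≡ count (_∈? X) (allFin n)
∣p∣≡count-allFin []            = refl
∣p∣≡count-allFin (inside ∷ X)  = cong suc (trans (∣p∣≡count-allFin X) (sym (count-∈-suc inside X)))
∣p∣≡count-allFin (outside ∷ X) = trans (∣p∣≡count-allFin X) (sym (count-∈-suc outside X))

∣p∣≡count-↭ : ∀ {P} → P ↭ allFin n → ∀ (X : Subset n) → ∣ X ∣ ≡ count (_∈? X) P
∣p∣≡count-↭ P↭ X = trans (∣p∣≡count-allFin X) (count-↭ (_∈? X) (↭-sym P↭))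

x∉p-x : ∀ (X : Subset n) x → x ∉ X - x
x∉p-x (_ ∷ X) zero    ()
x∉p-x (_ ∷ X) (suc x) (there x∈) = x∉p-x X x x∈

∈-⋂⁻ : ∀ {p : Fin n} Xs → p ∈ ⋂ Xs → All (p ∈_) Xs
∈-⋂⁻ []       _    = []
∈-⋂⁻ (X ∷ Xs) p∈ with x∈p∩q⁻ X (⋂ Xs) p∈
... | p∈X , p∈⋂Xs = p∈X ∷ ∈-⋂⁻ Xs p∈⋂Xs

count-∈∁ : ∀ (X : Subset n) xs → count (_∈? ∁ X) xs ≡ count (∁? (_∈? X)) xs
count-∈∁ X = count-≐ _ _ (x∈∁p⇒x∉p , x∉p⇒x∈∁p)

count-∈∁-swap : ∀ (S H : Subset n) xs → count (_∈? H) xs ≤ count (∁? (_∈? S)) xs →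
                count (_∈? S) xs ≤ count (_∈? ∁ H) xs
count-∈∁-swap S H xs H≤∁S = +-cancelʳ-≤ _ _ _ (begin
  count (_∈? S) xs + count (_∈? H) xs          ≤⟨ +-monoʳ-≤ (count (_∈? S) xs) H≤∁S ⟩
  count (_∈? S) xs + count (∁? (_∈? S)) xs     ≡⟨ count-+-count-∁ (_∈? S) xs ⟩
  length xs                                    ≡⟨ count-+-count-∁ (_∈? H) xs ⟨
  count (_∈? H) xs + count (∁? (_∈? H)) xs     ≡⟨ cong (count (_∈? H) xs +_) (count-∈∁ H xs) ⟨
  count (_∈? H) xs + count (_∈? ∁ H) xs        ≡⟨ +-comm (count (_∈? H) xs) _ ⟩
  count (_∈? ∁ H) xs + count (_∈? H) xs        ∎)
  where open ≤-Reasoning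

module _ (P : List (Fin n)) (b : ℕ) .{{_ : NonZero b}} where

  hand : ℕ → Subset n
  hand k = tabulate (does ∘ residue? b k ∘ position P)

  ∈-hand : ∀ p → p ∈ hand (position P p % b)
  ∈-hand p = ∈-tabulate⁺ (residue? b _ ∘ position P) refl

  count-hand : ∀ k → Unique P → ∀ y {C} → length (take y P) ≤ C * b →
               count (_∈? hand k) (take y P) ≤ C
  count-hand k unique y {C} short = begin
    count (_∈? hand k) (take y P)
      ≡⟨ count-∈-tabulate (residue? b k ∘ position P) (take y P) ⟩
    count (residue? b k ∘ position P) (take y P)
      ≡⟨ count-map (residue? b k) (position P) (take y P) ⟨
    count (residue? b k) (map (position P) (take y P))
      ≡⟨ cong (count (residue? b k)) (map-position-take y P unique) ⟩
    count (residue? b k) (upTo (length (take y P)))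
      ≤⟨ count-residue b k C short ⟩
    C
      ∎
    where open ≤-Reasoning

psum-cong : ∀ {u v : Fin t → ℕ} → (∀ j → u j ≡ v j) → ∀ i → psum u i ≡ psum v i
psum-cong u≗v zero    = u≗v zero
psum-cong u≗v (suc i) = cong₂ _+_ (u≗v zero) (psum-cong (u≗v ∘ suc) i)

psum-zero : ∀ (i : Fin t) → psum (λ _ → 0) i ≡ 0
psum-zero zero    = refl
psum-zero (suc i) = psum-zero i

psum-+ : ∀ (u v : Fin t → ℕ) i → psum (λ j → u j + v j) i ≡ psum u i + psum v i
psum-+ u v zero    = refl
psum-+ u v (suc i) = trans (cong (u zero + v zero +_) (psum-+ (u ∘ suc) (v ∘ suc) i))
                           (interchange (u zero) (v zero) _ _)

psum-count-singleton : ∀ (x i : Fin t) → psum (λ j → count (_≟ j) [ x ]) i ≡ count (_≤ᶠ? i) [ x ]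
psum-count-singleton zero    zero    = refl
psum-count-singleton (suc x) zero    = refl
psum-count-singleton zero    (suc i) = cong suc (psum-zero i)
psum-count-singleton (suc x) (suc i) =
  trans (psum-count-singleton x i) (count-≐ (_≤ᶠ? i) ((_≤ᶠ? suc i) ∘ suc) (s≤s , s≤s⁻¹) [ x ])

psum-count : ∀ (f : A → Fin t) xs i →
             psum (λ j → count (λ x → f x ≟ j) xs) i ≡ count (λ x → f x ≤ᶠ? i) xs
psum-count f []       i = psum-zero i
psum-count f (x ∷ xs) i = begin
  psum (λ j → count (in-j? j) (x ∷ xs)) i
    ≡⟨ psum-cong (λ j → count-++ (in-j? j) [ x ] xs) i ⟩
  psum (λ j → count (in-j? j) [ x ] + count (in-j? j) xs) i
    ≡⟨ psum-+ _ _ i ⟩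
  psum (λ j → count (_≟ j) [ f x ]) i + psum (λ j → count (in-j? j) xs) i
    ≡⟨ cong₂ _+_ (psum-count-singleton (f x) i) (psum-count f xs i) ⟩
  count (λ y → f y ≤ᶠ? i) [ x ] + count (λ y → f y ≤ᶠ? i) xs
    ≡⟨ count-++ (λ y → f y ≤ᶠ? i) [ x ] xs ⟨
  count (λ y → f y ≤ᶠ? i) (x ∷ xs)
    ∎
  where
  open ≡-Reasoning
  in-j? : ∀ j → Decidable (λ y → f y ≡ j)
  in-j? j y = f y ≟ j

module _ {c : Fin n → Fin t} {P : List (Fin n)} (P↭ : P ↭ allFin n) where

  classSize≡count : ∀ j → classSize c j ≡ count (λ p → c p ≟ j) P
  classSize≡count j = trans (∣p∣≡count-↭ P↭ (classSet c j)) (count-∈-tabulate (λ p → c p ≟ j) P)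

  psum-classSize : ∀ i → psum (classSize c) i ≡ count (λ p → c p ≤ᶠ? i) P
  psum-classSize i = trans (psum-cong classSize≡count i) (psum-count c P i)

  psum-classGap : ∀ {S m} → coalVec c S ≐ m → ∀ i →
                  psum (λ j → classSize c j ∸ m j) i ≡
                  count (λ p → c p ≤ᶠ? i) (filter (∁? (_∈? S)) P)
  psum-classGap {S} {m} S≐m i = trans (psum-cong gap i) (psum-count c (filter (∁? (_∈? S)) P) i)
    where
    inClass? : ∀ j → Decidable (λ p → c p ≡ j)
    inClass? j p = c p ≟ j
    m≡count : ∀ j → m j ≡ count (inClass? j) (filter (_∈? S) P)
    m≡count j = begin
      m j                                        ≡⟨ S≐m j ⟨
      ∣ S ∩ classSet c j ∣                       ≡⟨ ∣p∣≡count-↭ P↭ (S ∩ classSet c j) ⟩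
      count (_∈? S ∩ classSet c j) P             ≡⟨ count-≐ _ _ (∈∩⁻ , ∈∩⁺) P ⟩
      count ((_∈? S) ∩? inClass? j) P            ≡⟨ count-filter (_∈? S) (inClass? j) P ⟨
      count (inClass? j) (filter (_∈? S) P)      ∎
      where
      open ≡-Reasoning
      ∈∩⁻ : ∀ {p} → p ∈ S ∩ classSet c j → p ∈ S × c p ≡ j
      ∈∩⁻ p∈ with x∈p∩q⁻ S (classSet c j) p∈
      ... | p∈S , p∈N = p∈S , ∈-tabulate⁻ (inClass? j) p∈N
      ∈∩⁺ : ∀ {p} → p ∈ S × c p ≡ j → p ∈ S ∩ classSet c j
      ∈∩⁺ (p∈S , cp≡j) = x∈p∩q⁺ (p∈S , ∈-tabulate⁺ (inClass? j) cp≡j)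
    gap : ∀ j → classSize c j ∸ m j ≡ count (inClass? j) (filter (∁? (_∈? S)) P)
    gap j = begin
      classSize c j ∸ m j                          ≡⟨ cong₂ _∸_ (classSize≡count j) (m≡count j) ⟩
      count (inClass? j) P ∸ count (inClass? j) (filter (_∈? S) P)
        ≡⟨ cong (_∸ count (inClass? j) (filter (_∈? S) P)) (count-partition (_∈? S) (inClass? j) P) ⟩
      count (inClass? j) (filter (_∈? S) P) + count (inClass? j) (filter (∁? (_∈? S)) P)
        ∸ count (inClass? j) (filter (_∈? S) P)
        ≡⟨ m+n∸m≡n (count (inClass? j) (filter (_∈? S) P)) _ ⟩
      count (inClass? j) (filter (∁? (_∈? S)) P)   ∎
      where open ≡-Reasoning

max∞-bounded : ∀ {b} (rs : List (Maybe ℕ)) → List.foldr max∞ (just 0) rs ≡ just b →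
               All (λ r → Pointwise _≤_ r (just b)) rs
max∞-bounded []            _  = []
max∞-bounded (nothing ∷ _) ()
max∞-bounded (just r ∷ rs) eq with List.foldr max∞ (just 0) rs in eq′
... | just s  with refl ← eq = just (m≤m⊔n r s) ∷ All.map raise (max∞-bounded rs eq′)
  where
  raise : ∀ {r′} → Pointwise _≤_ r′ (just s) → Pointwise _≤_ r′ (just (r ⊔ s))
  raise (just r′≤s) = just (≤-trans r′≤s (m≤n⊔m r s))
... | nothing with () ← eq

ceilDiv∞-bounded : ∀ p q {b} → Pointwise _≤_ (ceilDiv∞ p q) (just b) → p ≤ b * q
ceilDiv∞-bounded p (suc q) {b} (just ⌈p/q⌉≤b) = begin
  p          ≤⟨ +-cancelʳ-≤ q p _ p+q≤ ⟩
  d * suc q  ≤⟨ *-monoˡ-≤ (suc q) ⌈p/q⌉≤b ⟩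
  b * suc q  ∎
  where
  open ≤-Reasoning
  d : ℕ
  d = (p + q) / suc q
  p+q≤ : p + q ≤ d * suc q + q
  p+q≤ = begin
    p + q                        ≡⟨ m≡m%n+[m/n]*n (p + q) (suc q) ⟩
    (p + q) % suc q + d * suc q  ≤⟨ +-monoˡ-≤ (d * suc q) (s≤s⁻¹ (m%n<n (p + q) (suc q))) ⟩
    q + d * suc q                ≡⟨ +-comm q (d * suc q) ⟩
    d * suc q + q                ∎

class-bound : ∀ {c : Fin n → Fin t} {m S b P} →
              P ↭ allFin n → coalVec c S ≐ m → bound c m ≡ just b →
              ∀ i → count (λ p → c p ≤ᶠ? i) P ≤ b * count (λ p → c p ≤ᶠ? i) (filter (∁? (_∈? S)) P)
class-bound {t = t} {c = c} {m} {S} {b} {P} P↭ S≐m bound≡b i = begin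
  count (λ p → c p ≤ᶠ? i) P                               ≡⟨ psum-classSize P↭ i ⟨
  psum (classSize c) i                                    ≤⟨ ceilDiv∞-bounded _ _ at-i ⟩
  b * psum (λ j → classSize c j ∸ m j) i                  ≡⟨ cong (b *_) (psum-classGap P↭ S≐m i) ⟩
  b * count (λ p → c p ≤ᶠ? i) (filter (∁? (_∈? S)) P)     ∎
  where
  open ≤-Reasoning
  ratio : Fin t → Maybe ℕ
  ratio i = ceilDiv∞ (psum (classSize c) i) (psum (λ j → classSize c j ∸ m j) i)
  at-i : Pointwise _≤_ (ratio i) (just b)
  at-i = All.lookup (All.map⁻ (max∞-bounded (map ratio (allFin t)) bound≡b)) (∈-allFin i)

-- Winning is inherited along prefix domination

PrefixDominated : List (Fin n) → Subset n → Subset n → Set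
PrefixDominated P S T = ∀ y → count (_∈? S) (take y P) ≤ count (_∈? T) (take y P)

first-member : ∀ (S : Subset n) L → All (_∉ S) L ⊎
  ∃[ j ] (j ∈ₗ L × j ∈ S × ∀ y → count (_∈? S - j) (take y L) ≤ pred (count (_∈? S) (take y L)))
first-member S [] = inj₁ []
first-member S (q ∷ L) with q ∈? S
... | yes q∈S = inj₂ (q , here refl , q∈S , removal)
  where
  removal : ∀ y → count (_∈? S - q) (take y (q ∷ L)) ≤ pred (count (_∈? S) (take y (q ∷ L)))
  removal zero    = z≤n
  removal (suc y) = begin
    count (_∈? S - q) (q ∷ take y L)  ≡⟨ count-reject (_∈? S - q) (take y L) (x∉p-x S q) ⟩
    count (_∈? S - q) (take y L)      ≤⟨ count-mono _ (_∈? S) (take y L) (λ _ → p─q⊆p S ⁅ q ⁆) ⟩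
    count (_∈? S) (take y L)          ≡⟨ cong pred (count-accept (_∈? S) (take y L) q∈S) ⟨
    pred (count (_∈? S) (q ∷ take y L)) ∎
    where open ≤-Reasoning
... | no q∉S with first-member S L
...   | inj₁ none = inj₁ (q∉S ∷ none)
...   | inj₂ (j , j∈L , j∈S , removal) = inj₂ (j , there j∈L , j∈S , removal′)
  where
  removal′ : ∀ y → count (_∈? S - j) (take y (q ∷ L)) ≤ pred (count (_∈? S) (take y (q ∷ L)))
  removal′ zero    = z≤n
  removal′ (suc y) = begin
    count (_∈? S - j) (q ∷ take y L)  ≡⟨ count-reject _ (take y L) (q∉S ∘ p─q⊆p S ⁅ j ⁆) ⟩
    count (_∈? S - j) (take y L)      ≤⟨ removal y ⟩
    pred (count (_∈? S) (take y L))   ≡⟨ cong pred (count-reject (_∈? S) (take y L) q∉S) ⟨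
    pred (count (_∈? S) (q ∷ take y L)) ∎
    where open ≤-Reasoning

_⊆_off_ : Subset n → Subset n → List (Fin n) → Set
S ⊆ T off P = ∀ {p} → p ∉ₗ P → p ∈ S → p ∈ T

⊆-off-∷ : ∀ {z P} {S T : Subset n} → (z ∈ S → z ∈ T) → S ⊆ T off (z ∷ P) → S ⊆ T off P
⊆-off-∷ {z = z} z∈S⇒z∈T S⊆T {p} p∉P p∈S with p ≟ z
... | yes refl = z∈S⇒z∈T p∈S
... | no  p≢z  = S⊆T (λ { (here p≡z) → p≢z p≡z ; (there p∈P) → p∉P p∈P }) p∈S

module _ {W : Subset n → Set} (game : IsSimpleGame W) where
  open IsSimpleGame game

  prefix-dominated-winning : ∀ P {S T} → Unique P → AllPairs (Desirable W) P →
                             S ⊆ T off P → PrefixDominated P S T → W S → W T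
  prefix-dominated-winning [] _ _ S⊆T _ = monotone (S⊆T λ ())
  prefix-dominated-winning (z ∷ P) {S} {T} (z≢P ∷ unique) (z⊒P ∷ sorted) S⊆T dom
    with z ∈? S | z ∈? T
  ... | yes z∈S | yes z∈T =
    prefix-dominated-winning P unique sorted (⊆-off-∷ (λ _ → z∈T) S⊆T) λ y →
      s≤s⁻¹ (subst₂ _≤_ (count-accept (_∈? S) (take y P) z∈S) (count-accept (_∈? T) (take y P) z∈T)
                        (dom (suc y)))
  ... | no z∉S  | no z∉T  =
    prefix-dominated-winning P unique sorted (⊆-off-∷ (λ z∈S → contradiction z∈S z∉S) S⊆T) λ y →
      subst₂ _≤_ (count-reject (_∈? S) (take y P) z∉S) (count-reject (_∈? T) (take y P) z∉T) (dom (suc y))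
  ... | yes z∈S | no z∉T  =
    contradiction (subst₂ _≤_ (count-accept (_∈? S) [] z∈S) (count-reject (_∈? T) [] z∉T) (dom 1)) λ ()
  ... | no z∉S  | yes z∈T with first-member S P
  ...   | inj₁ none = monotone λ p∈S → S⊆T (λ { (here p≡z) → z∉S (subst (_∈ S) p≡z p∈S)
                                            ; (there p∈P) → All.lookup none p∈P p∈S }) p∈S
  -- z precedes the first member j of S in P, so S may trade j for z without losing prefix domination.
  ...   | inj₂ (j , j∈P , j∈S , removal) =
    prefix-dominated-winning P unique sorted S′⊆T dom′ ∘ All.lookup z⊒P j∈P S j∈S z∉S
    where
    S′ : Subset n
    S′ = (S - j) ∪ ⁅ z ⁆
    S′⊆T : S′ ⊆ T off P
    S′⊆T {p} p∉P p∈S′ with x∈p∪q⁻ (S - j) ⁅ z ⁆ p∈S′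
    ... | inj₂ p∈⁅z⁆ = subst (_∈ T) (sym (x∈⁅y⁆⇒x≡y z p∈⁅z⁆)) z∈T
    ... | inj₁ p∈S-j = S⊆T (λ { (here p≡z) → z∉S (subst (_∈ S) p≡z p∈S)
                              ; (there p∈P) → p∉P p∈P }) p∈S
      where
      p∈S : p ∈ S
      p∈S = p─q⊆p S ⁅ j ⁆ p∈S-j
    dom′ : PrefixDominated P S′ T
    dom′ y = begin
      count (_∈? S′) (take y P)            ≤⟨ count-mono (_∈? S′) (_∈? S - j) (take y P) z∉prefix ⟩
      count (_∈? S - j) (take y P)        ≤⟨ removal y ⟩
      pred (count (_∈? S) (take y P))     ≡⟨ cong pred (count-reject (_∈? S) (take y P) z∉S) ⟨
      pred (count (_∈? S) (z ∷ take y P)) ≤⟨ pred-mono-≤ (dom (suc y)) ⟩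
      pred (count (_∈? T) (z ∷ take y P)) ≡⟨ cong pred (count-accept (_∈? T) (take y P) z∈T) ⟩
      count (_∈? T) (take y P)            ∎
      where
      open ≤-Reasoning
      z∉prefix : ∀ {p} → p ∈ₗ take y P → p ∈ S′ → p ∈ S - j
      z∉prefix p∈ p∈S′ with x∈p∪q⁻ (S - j) ⁅ z ⁆ p∈S′
      ... | inj₁ p∈S-j = p∈S-j
      ... | inj₂ p∈⁅z⁆ =
        contradiction (sym (x∈⁅y⁆⇒x≡y z p∈⁅z⁆)) (All.lookup (All.take⁺ y z≢P) p∈)

  ν≤-round-robin : ∀ {P S₀} b .{{_ : NonZero b}} →
                   Unique P → (∀ p → p ∈ₗ P) → AllPairs (Desirable W) P → W S₀ →
                   (∀ y → length (take y P) ≤ b * count (∁? (_∈? S₀)) (take y P)) → ν≤ W b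
  ν≤-round-robin {P} {S₀} b unique complete sorted S₀-wins dense =
    map T (upTo b) ,
    ≤-reflexive (trans (length-map T (upTo b)) (length-upTo b)) ,
    All.map⁺ (All.tabulate λ _ → T-wins _) ,
    Empty-unique λ (p , p∈⋂) →
      let p∈all = All.map⁻ (∈-⋂⁻ (map T (upTo b)) p∈⋂)
      in x∈∁p⇒x∉p (All.lookup p∈all (∈-upTo⁺ (m%n<n (position P p) b))) (∈-hand P b p)
    where
    T : ℕ → Subset n
    T k = ∁ (hand P b k)
    T-wins : ∀ k → W (T k)
    T-wins k = prefix-dominated-winning P unique sorted (λ p∉P _ → contradiction (complete _) p∉P)
      (λ y → count-∈∁-swap S₀ (hand P b k) (take y P)
               (count-hand P b k unique y (≤-trans (dense y) (≤-reflexive (*-comm b _)))))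
      S₀-wins

-- Listing the players class by class, outsiders of S₀ first

AllPairs-++-∷⁻ : ∀ {R : Rel A ℓ} xs {y ys} → AllPairs R (xs ++ y ∷ ys) →
                 All (λ x → R x y) xs × All (R y) ys
AllPairs-++-∷⁻ []       (y≤ys ∷ _)    = [] , y≤ys
AllPairs-++-∷⁻ (x ∷ xs) (x≤xs ∷ rest) with AllPairs-++-∷⁻ xs rest
... | xs≤y , y≤ys = All.lookup x≤xs (∈-++⁺ʳ xs (here refl)) ∷ xs≤y , y≤ys

module _ {a} {A : Set a} (key : A → ℕ) where
  private
    byKey : DecTotalOrder a 0ℓ 0ℓ
    byKey = On.decTotalOrder ≤-decTotalOrder key
  open Data.List.Sort byKey using (sort; sort-↭; sort-↗)

  sortOn : List A → List A
  sortOn = sort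

  sortOn-↭ : ∀ xs → sortOn xs ↭ xs
  sortOn-↭ = sort-↭

  sortOn-sorted : ∀ xs → AllPairs (λ x y → key x ≤ key y) (sortOn xs)
  sortOn-sorted xs = Sorted⇒AllPairs (DecTotalOrder.totalOrder byKey) (sort-↗ xs)

*2≤1+*2⇒≤ : ∀ {x y} → 2 * x ≤ suc (2 * y) → x ≤ y
*2≤1+*2⇒≤ {x} {y} 2x≤ = ≮⇒≥ λ y<x → 1+n≰n (s≤s⁻¹ (begin
  suc (suc (2 * y))  ≡⟨ *-suc 2 y ⟨
  2 * suc y          ≤⟨ *-monoʳ-≤ 2 y<x ⟩
  2 * x              ≤⟨ 2x≤ ⟩
  suc (2 * y)        ∎))
  where open ≤-Reasoning

module Arrangement (c : Fin n → Fin t) (S₀ : Subset n) where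

  key : Fin n → ℕ
  key p with p ∈? S₀
  ... | yes _ = suc (2 * toℕ (c p))
  ... | no  _ = 2 * toℕ (c p)

  key-∉ : ∀ {p} → p ∉ S₀ → key p ≡ 2 * toℕ (c p)
  key-∉ {p} p∉S₀ with p ∈? S₀
  ... | yes p∈S₀ = contradiction p∈S₀ p∉S₀
  ... | no  _    = refl

  key-∈ : ∀ {p} → p ∈ S₀ → key p ≡ suc (2 * toℕ (c p))
  key-∈ {p} p∈S₀ with p ∈? S₀
  ... | yes _    = refl
  ... | no  p∉S₀ = contradiction p∈S₀ p∉S₀

  key-bounds : ∀ p → 2 * toℕ (c p) ≤ key p × key p ≤ suc (2 * toℕ (c p))
  key-bounds p with p ∈? S₀
  ... | yes _ = n≤1+n _ , ≤-refl
  ... | no  _ = ≤-refl , n≤1+n _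

  key-≤⇒class-≤ : ∀ {p q} → key p ≤ key q → c p ≤ᶠ c q
  key-≤⇒class-≤ {p} {q} kp≤kq =
    *2≤1+*2⇒≤ (≤-trans (proj₁ (key-bounds p)) (≤-trans kp≤kq (proj₂ (key-bounds q))))

  key-outsider<insider : ∀ {p q} → p ∉ S₀ → q ∈ S₀ → c p ≤ᶠ c q → key p < key q
  key-outsider<insider {p} {q} p∉S₀ q∈S₀ cp≤cq = begin-strict
    key p                ≡⟨ key-∉ p∉S₀ ⟩
    2 * toℕ (c p)        ≤⟨ *-monoʳ-≤ 2 cp≤cq ⟩
    2 * toℕ (c q)        <⟨ ≤-refl ⟩
    suc (2 * toℕ (c q))  ≡⟨ key-∈ q∈S₀ ⟨
    key q                ∎
    where open ≤-Reasoning

  outsider? : Decidable (_∉ S₀)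
  outsider? = ∁? (_∈? S₀)

  module _ (b : ℕ) (1≤b : 1 ≤ b) (P : List (Fin n)) (sorted : AllPairs (λ p q → key p ≤ key q) P)
           (class-bound : ∀ (i : Fin t) →
             count (λ p → c p ≤ᶠ? i) P ≤ b * count (λ p → c p ≤ᶠ? i) (filter outsider? P))
           where

    -- Such a prefix lies within the classes up to that of z and contains all their outsiders.
    prefix-ending-inside-bound : ∀ D {z} E → D ++ z ∷ E ≡ P → z ∈ S₀ →
                                 length (D ∷ʳ z) ≤ b * count outsider? (D ∷ʳ z)
    prefix-ending-inside-bound D {z} E eq z∈S₀ = begin
      length (D ∷ʳ z)                                    ≡⟨ count-all ≤cz? in-class ⟨
      count ≤cz? (D ∷ʳ z)                                ≤⟨ m≤m+n _ _ ⟩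
      count ≤cz? (D ∷ʳ z) + count ≤cz? E                 ≡⟨ count-++ ≤cz? (D ∷ʳ z) E ⟨
      count ≤cz? ((D ∷ʳ z) ++ E)                         ≡⟨ cong (count ≤cz?) eq′ ⟩
      count ≤cz? P                                       ≤⟨ class-bound (c z) ⟩
      b * count ≤cz? (filter outsider? P)
        ≡⟨ cong (λ L → b * count ≤cz? (filter outsider? L)) eq′ ⟨
      b * count ≤cz? (filter outsider? ((D ∷ʳ z) ++ E))
        ≡⟨ cong (b *_) outsiders-in-prefix ⟩
      b * count ≤cz? (filter outsider? (D ∷ʳ z))
        ≤⟨ *-monoʳ-≤ b (count-filter-≤ outsider? ≤cz? (D ∷ʳ z)) ⟩
      b * count outsider? (D ∷ʳ z)
        ∎
      where
      open ≤-Reasoning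
      ≤cz? : Decidable (λ p → c p ≤ᶠ c z)
      ≤cz? p = c p ≤ᶠ? c z
      eq′ : (D ∷ʳ z) ++ E ≡ P
      eq′ = trans (++-assoc D [ z ] E) eq
      around : All (λ x → key x ≤ key z) D × All (λ x → key z ≤ key x) E
      around = AllPairs-++-∷⁻ D (subst (AllPairs _) (sym eq) sorted)
      in-class : All (λ x → c x ≤ᶠ c z) (D ∷ʳ z)
      in-class = All.∷ʳ⁺ (All.map key-≤⇒class-≤ (proj₁ around)) ≤ᶠ-refl
      later-outsiders-above : All (λ x → ¬ c x ≤ᶠ c z) (filter outsider? E)
      later-outsiders-above =
        All.zipWith (λ (z≤x , x∉S₀) x≤z → <⇒≱ (key-outsider<insider x∉S₀ z∈S₀ x≤z) z≤x)
                    (All.filter⁺ outsider? (proj₂ around) , All.all-filter outsider? E)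
      outsiders-in-prefix : count ≤cz? (filter outsider? ((D ∷ʳ z) ++ E)) ≡
                            count ≤cz? (filter outsider? (D ∷ʳ z))
      outsiders-in-prefix = begin-equality
        count ≤cz? (filter outsider? ((D ∷ʳ z) ++ E))
          ≡⟨ cong (count ≤cz?) (filter-++ outsider? (D ∷ʳ z) E) ⟩
        count ≤cz? (filter outsider? (D ∷ʳ z) ++ filter outsider? E)
          ≡⟨ count-++ ≤cz? (filter outsider? (D ∷ʳ z)) _ ⟩
        count ≤cz? (filter outsider? (D ∷ʳ z)) + count ≤cz? (filter outsider? E)
          ≡⟨ cong (count ≤cz? (filter outsider? (D ∷ʳ z)) +_) (count-none ≤cz? later-outsiders-above) ⟩
        count ≤cz? (filter outsider? (D ∷ʳ z)) + 0
          ≡⟨ +-identityʳ _ ⟩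
        count ≤cz? (filter outsider? (D ∷ʳ z))
          ∎

    prefix-bound-snoc : ∀ {D} → Reverse D → ∀ E → D ++ E ≡ P → length D ≤ b * count outsider? D
    prefix-bound-snoc []            E _  = z≤n
    prefix-bound-snoc (D ∶ rv ∶ʳ z) E eq with z ∈? S₀
    ... | yes z∈S₀ = prefix-ending-inside-bound D E (trans (sym (++-assoc D [ z ] E)) eq) z∈S₀
    ... | no  z∉S₀ = begin
      length (D ∷ʳ z)                          ≡⟨ length-++ D ⟩
      length D + 1                             ≤⟨ +-mono-≤ (prefix-bound-snoc rv (z ∷ E) eq′) 1≤b ⟩
      b * count outsider? D + b                ≡⟨ cong (b * count outsider? D +_) (*-identityʳ b) ⟨
      b * count outsider? D + b * 1            ≡⟨ *-distribˡ-+ b _ 1 ⟨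
      b * (count outsider? D + 1)              ≡⟨ cong (λ k → b * (count outsider? D + k)) z-outside ⟨
      b * (count outsider? D + count outsider? [ z ])
                                               ≡⟨ cong (b *_) (count-++ outsider? D [ z ]) ⟨
      b * count outsider? (D ∷ʳ z)             ∎
      where
      open ≤-Reasoning
      eq′ : D ++ z ∷ E ≡ P
      eq′ = trans (sym (++-assoc D [ z ] E)) eq
      z-outside : count outsider? [ z ] ≡ 1
      z-outside = count-accept outsider? [] z∉S₀

    prefix-bound : ∀ y → length (take y P) ≤ b * count outsider? (take y P)
    prefix-bound y = prefix-bound-snoc (reverseView (take y P)) (drop y P) (take++drop≡id y P)

ν≤-of-winning-coalition : ∀ {W : Subset n → Set} {c : Fin n → Fin t} {m S₀ b} →
                          IsSimpleGame W → IsClassMap W c → W S₀ → coalVec c S₀ ≐ m →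
                          bound c m ≡ just b → ν≤ W b
-- With b = 0 the class bound leaves no players, so the empty family has empty intersection.
ν≤-of-winning-coalition {n} {c = c} {m} {S₀} {zero} _ _ _ S₀≐m bound≡0 =
  [] , z≤n , [] , Empty-unique λ (p , _) →
    <⇒≱ (count-pos (λ q → c q ≤ᶠ? c p) (∈-allFin p) ≤ᶠ-refl)
        (class-bound {c = c} {m} {S₀} {P = allFin n} ↭-refl S₀≐m bound≡0 (c p))
ν≤-of-winning-coalition {n} {W = W} {c} {S₀ = S₀} {b@(suc _)} game classMap S₀-wins S₀≐m bound≡b =
  ν≤-round-robin game b unique complete desirable S₀-wins
    (prefix-bound b (s≤s z≤n) P sorted (class-bound P↭ S₀≐m bound≡b))
  where
  open Arrangement c S₀
  P : List (Fin n)
  P = sortOn key (allFin n)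
  P↭ : P ↭ allFin n
  P↭ = sortOn-↭ key (allFin n)
  unique : Unique P
  unique = Unique-resp-↭ (setoid (Fin n)) (↭⇒↭ₛ (↭-sym P↭)) (allFin⁺ n)
  complete : ∀ p → p ∈ₗ P
  complete p = ∈-resp-↭ (↭-sym P↭) (∈-allFin p)
  sorted : AllPairs (λ p q → key p ≤ key q) P
  sorted = sortOn-sorted key (allFin n)
  desirable : AllPairs (Desirable W) P
  desirable =
    AllPairs.map (λ {p} {q} → Equivalence.to (IsClassMap.order classMap p q) ∘ key-≤⇒class-≤) sorted

proposition5 : (n t : ℕ) (W : Subset n → Set) (c : Fin n → Fin t) →
    IsSimpleGame W → IsComplete W → IsClassMap W c →
    (m : Fin t → ℕ) → IsShiftMinWinning W c m →
    (b : ℕ) → bound c m ≡ just b → ν≤ W b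
proposition5 n t W c game _ classMap m shiftMin b bound≡b =
  let S₀ , S₀≐m , S₀-wins = IsShiftMinWinning.winning shiftMin
  in ν≤-of-winning-coalition game classMap S₀-wins S₀≐m bound≡b
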